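{- Let $n,b,a$ be positive integers and let $x_1,x_i,x_{i+1},x_{i+2}$ be vertices of $G_{b,a}$ such that $\{x_i,x_{i+1}\}$ and $\{x_{i+1},x_{i+2}\}$ are edges of $G_{b,a}$. For each vertex $x_j$ let $A_j\subseteq\{1,\dots,n\}$ be the set of coordinates where $x_j$ has a $1$. If $|A_1\cap A_i|=\alpha$, then $|A_1\cap A_{i+2}|\le\alpha+n+2a-2b$.
   Context: For positive integers $n$, $b$, $a$, the graph $G_{b,a}=(V_b,E_a)$ has vertex set $V_b=\{x=(x_1,\dots,x_n): x_i\in\{0,1\},\ x_1+\dots+x_n=b\}$ and edge set $E_a=\{\{x,y\}: x,y\in V_b,\ (x,y)=a\}$, where $(x,y)$ is the standard inner product. -}

module Defs where

open import Data.Nat using (ℕ; _+_; _*_)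
open import Data.Bool using (Bool; true; false)
open import Data.Vec using (Vec; []; _∷_)
open import Data.Fin.Subset using (Subset)
open import Relation.Binary.PropositionalEquality using (_≡_)

bit : Bool → ℕ
bit true  = 1
bit false = 0

-- a 0/1 vector x = (x_1,…,x_n) is represented as Vec Bool n
-- coordinate sum x_1 + … + x_n
weight : ∀ {n} → Vec Bool n → ℕ
weight []       = 0
weight (x ∷ xs) = bit x + weight xs

inner : ∀ {n} → Vec Bool n → Vec Bool n → ℕ
inner []       []       = 0
inner (x ∷ xs) (y ∷ ys) = bit x * bit y + inner xs ys

IsVertex : ∀ {n} → ℕ → Vec Bool n → Set
IsVertex b x = weight x ≡ b

IsEdge : ∀ {n} → ℕ → ℕ → Vec Bool n → Vec Bool n → Set
IsEdge b a x y = inner x y ≡ a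

support : ∀ {n} → Vec Bool n → Subset n
support x = x

-- Coordinatewise, [i ∈ A ∩ D] + Bᵢ + Cᵢ ≤ [i ∈ A ∩ B] + 1 + BᵢCᵢ + CᵢDᵢ, as one checks on the
-- sixteen 0/1 patterns. Summing over the n coordinates gives
-- |A ∩ D| + |B| + |C| ≤ |A ∩ B| + n + (B,C) + (C,D), which for consecutive edges B C, C D
-- of G_{b,a} reads |A ∩ D| + 2b ≤ α + n + 2a.
module Submission where

open import Defs
open import Data.Nat using (ℕ; _>_)
open import Data.Bool using (Bool)
open import Data.Vec using (Vec)
open import Data.Fin.Subset using (∣_∣; _∩_)
open import Data.Integer using (+_; _+_; _-_; _≤_; +≤+)
open import Relation.Binary.PropositionalEquality using (_≡_)

open import Data.Bool using (true; false; _∧_)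
open import Data.Vec using ([]; _∷_)
open import Data.Nat as ℕ using (suc; _*_; _≤?_; z≤n)
open import Data.Nat.Properties as ℕ using (+-identityʳ; +-mono-≤; m+n≤o⇒m≤o∸n; m+n≤o⇒n≤o)
import Data.Integer.Properties as ℤ
open import Data.Nat.Tactic.RingSolver using (solve-∀)
open import Relation.Nullary.Decidable using (True; toWitness)
open import Relation.Binary.PropositionalEquality using (refl; sym; trans; cong; cong₂; subst)

∣x∷p∣≡bit[x]+∣p∣ : ∀ {n} x (p : Vec Bool n) → ∣ x ∷ p ∣ ≡ bit x ℕ.+ ∣ p ∣
∣x∷p∣≡bit[x]+∣p∣ true  p = refl
∣x∷p∣≡bit[x]+∣p∣ false p = refl

m+n≤o⇒+m≤+o-+n : ∀ m {n o} → m ℕ.+ n ℕ.≤ o → + m ≤ + o - + n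
m+n≤o⇒+m≤+o-+n m {n} {o} m+n≤o =
  subst (+ m ≤_) (sym (trans (ℤ.m-n≡m⊖n o n) (ℤ.≤-⊖ (m+n≤o⇒n≤o m m+n≤o))))
        (+≤+ (m+n≤o⇒m≤o∸n m m+n≤o))

≤-by-evaluation : ∀ {m n} → True (m ≤? n) → m ℕ.≤ n
≤-by-evaluation = toWitness

coordinate-bound : ∀ a b c d →
  bit (a ∧ d) ℕ.+ (bit b ℕ.+ bit c) ℕ.≤ bit (a ∧ b) ℕ.+ 1 ℕ.+ (bit b * bit c ℕ.+ bit c * bit d)
coordinate-bound true  true  true  true  = ≤-by-evaluation _
coordinate-bound true  true  true  false = ≤-by-evaluation _
coordinate-bound true  true  false true  = ≤-by-evaluation _
coordinate-bound true  true  false false = ≤-by-evaluation _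
coordinate-bound true  false true  true  = ≤-by-evaluation _
coordinate-bound true  false true  false = ≤-by-evaluation _
coordinate-bound true  false false true  = ≤-by-evaluation _
coordinate-bound true  false false false = ≤-by-evaluation _
coordinate-bound false true  true  true  = ≤-by-evaluation _
coordinate-bound false true  true  false = ≤-by-evaluation _
coordinate-bound false true  false true  = ≤-by-evaluation _
coordinate-bound false true  false false = ≤-by-evaluation _
coordinate-bound false false true  true  = ≤-by-evaluation _
coordinate-bound false false true  false = ≤-by-evaluation _
coordinate-bound false false false true  = ≤-by-evaluation _
coordinate-bound false false false false = ≤-by-evaluation _

intersection-two-step-bound : ∀ {n} (A B C D : Vec Bool n) →
  ∣ A ∩ D ∣ ℕ.+ (weight B ℕ.+ weight C) ℕ.≤ ∣ A ∩ B ∣ ℕ.+ n ℕ.+ (inner B C ℕ.+ inner C D)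
intersection-two-step-bound [] [] [] [] = z≤n
intersection-two-step-bound {suc n} (a ∷ A) (b ∷ B) (c ∷ C) (d ∷ D) = begin
  ∣ (a ∧ d) ∷ A ∩ D ∣ ℕ.+ (bit b ℕ.+ weight B ℕ.+ (bit c ℕ.+ weight C))
    ≡⟨ cong (ℕ._+ _) (∣x∷p∣≡bit[x]+∣p∣ (a ∧ d) (A ∩ D)) ⟩
  bit (a ∧ d) ℕ.+ ∣ A ∩ D ∣ ℕ.+ (bit b ℕ.+ weight B ℕ.+ (bit c ℕ.+ weight C))
    ≡⟨ split (bit (a ∧ d)) ∣ A ∩ D ∣ (bit b) (weight B) (bit c) (weight C) ⟩
  bit (a ∧ d) ℕ.+ (bit b ℕ.+ bit c) ℕ.+ (∣ A ∩ D ∣ ℕ.+ (weight B ℕ.+ weight C))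
    ≤⟨ +-mono-≤ (coordinate-bound a b c d) (intersection-two-step-bound A B C D) ⟩
  bit (a ∧ b) ℕ.+ 1 ℕ.+ (bit b * bit c ℕ.+ bit c * bit d)
    ℕ.+ (∣ A ∩ B ∣ ℕ.+ n ℕ.+ (inner B C ℕ.+ inner C D))
    ≡⟨ merge (bit (a ∧ b)) ∣ A ∩ B ∣ (bit b * bit c) (inner B C) (bit c * bit d) (inner C D) n ⟩
  bit (a ∧ b) ℕ.+ ∣ A ∩ B ∣ ℕ.+ suc n
    ℕ.+ (bit b * bit c ℕ.+ inner B C ℕ.+ (bit c * bit d ℕ.+ inner C D))
    ≡⟨ cong (λ k → k ℕ.+ suc n ℕ.+ _) (∣x∷p∣≡bit[x]+∣p∣ (a ∧ b) (A ∩ B)) ⟨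
  ∣ (a ∧ b) ∷ A ∩ B ∣ ℕ.+ suc n
    ℕ.+ (bit b * bit c ℕ.+ inner B C ℕ.+ (bit c * bit d ℕ.+ inner C D)) ∎
  where
  open ℕ.≤-Reasoning
  split : ∀ x y z w u v →
    x ℕ.+ y ℕ.+ (z ℕ.+ w ℕ.+ (u ℕ.+ v)) ≡ x ℕ.+ (z ℕ.+ u) ℕ.+ (y ℕ.+ (w ℕ.+ v))
  split = solve-∀
  merge : ∀ x y z w u v m →
    x ℕ.+ 1 ℕ.+ (z ℕ.+ u) ℕ.+ (y ℕ.+ m ℕ.+ (w ℕ.+ v))
      ≡ x ℕ.+ y ℕ.+ suc m ℕ.+ (z ℕ.+ w ℕ.+ (u ℕ.+ v))
  merge = solve-∀

lemma1 : (n b a : ℕ) → n > 0 → b > 0 → a > 0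
    → (x₁ xᵢ xᵢ₊₁ xᵢ₊₂ : Vec Bool n)
    → IsVertex b x₁ → IsVertex b xᵢ → IsVertex b xᵢ₊₁ → IsVertex b xᵢ₊₂
    → IsEdge b a xᵢ xᵢ₊₁ → IsEdge b a xᵢ₊₁ xᵢ₊₂
    → (α : ℕ) → ∣ support x₁ ∩ support xᵢ ∣ ≡ α
    → + ∣ support x₁ ∩ support xᵢ₊₂ ∣ ≤ ((+ α + + n) + + (2 Data.Nat.* a)) - + (2 Data.Nat.* b)
lemma1 n b a _ _ _ A B C D _ wB wC _ eBC eCD α eα = m+n≤o⇒+m≤+o-+n ∣ A ∩ D ∣ (begin
  ∣ A ∩ D ∣ ℕ.+ 2 * b                                  ≡⟨ cong (∣ A ∩ D ∣ ℕ.+_) (double b) ⟩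
  ∣ A ∩ D ∣ ℕ.+ (b ℕ.+ b)                              ≡⟨ cong₂ (λ u v → ∣ A ∩ D ∣ ℕ.+ (u ℕ.+ v)) wB wC ⟨
  ∣ A ∩ D ∣ ℕ.+ (weight B ℕ.+ weight C)                ≤⟨ intersection-two-step-bound A B C D ⟩
  ∣ A ∩ B ∣ ℕ.+ n ℕ.+ (inner B C ℕ.+ inner C D)        ≡⟨ cong₂ (λ u v → u ℕ.+ n ℕ.+ v) eα (cong₂ ℕ._+_ eBC eCD) ⟩
  α ℕ.+ n ℕ.+ (a ℕ.+ a)                                ≡⟨ cong (α ℕ.+ n ℕ.+_) (double a) ⟨
  α ℕ.+ n ℕ.+ 2 * a                                    ∎)
  where
  open ℕ.≤-Reasoning
  double : ∀ m → 2 * m ≡ m ℕ.+ m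
  double m = cong (m ℕ.+_) (+-identityʳ m)
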